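{- Let $G$ be a finite connected graph and $\phi$ an order map on $G$. Then $\phi$ is tree-compatible if and only if for all spanning trees $T,T'$ and every $k\in\{0,\dots,|E(G)|-1\}$, $$T\cap\{\phi_1(T),\dots,\phi_k(T)\}=T'\cap\{\phi_1(T),\dots,\phi_k(T)\}\implies\forall j\in\{1,\dots,k+1\},\ \phi_j(T)=\phi_j(T').$$
   Context: Graphs may have loops and multiple edges; spanning trees are identified with their edge sets. An order map is a map $\phi$ sending each spanning tree $T$ of $G$ to a total order on $E(G)$; $\phi_k(T)$ denotes the $k$-th smallest edge for $\phi(T)$. A decision tree for $G$ is a perfect binary tree whose nodes are labelled by edges of $G$ such that along every root-to-leaf path the labels form a permutation of $E(G)$. Given a decision tree $\Delta$ and a spanning tree $T$, the $(\Delta,T)$-ordering is obtained by starting at the root of $\Delta$, recording the label, going to the left child if that edge is not in $T$ and to the right child if it is in $T$, until a leaf is passed; the sequence of labels read gives the order. $\phi$ is tree-compatible if there exists a decision tree $\Delta_\phi$ such that for every spanning tree $T$ the $(\Delta_\phi,T)$-ordering coincides with $\phi(T)$. -}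

module Defs where

open import Data.Nat using (ℕ; zero; suc; _<ᵇ_; _≤_; _<_; NonZero)
open import Data.Bool using (Bool; true; false; if_then_else_)
open import Data.Fin using (Fin; toℕ)
open import Data.Fin.Subset using (Subset; _∈_; _∩_)
open import Data.Fin.Permutation using (Permutation′; _⟨$⟩ʳ_; _⟨$⟩ˡ_)
open import Data.Vec using (Vec; []; _∷_; lookup; tabulate)
open import Data.List using (List; []; _∷_)
open import Data.List.Relation.Unary.Unique.Propositional using (Unique)
import Data.List.Membership.Propositional as LM
import Data.Vec.Membership.Propositional as VM
open import Data.Vec.Relation.Unary.Unique.Propositional renaming (Unique to VUnique)
open import Data.Product using (Σ; _×_; _,_; ∃)
open import Data.Sum using (_⊎_)
open import Relation.Binary.PropositionalEquality using (_≡_)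
open import Relation.Nullary using (¬_)

-- A finite multigraph (loops and parallel edges allowed):
-- vertices Fin V, edges Fin E, each edge has an (unordered) pair of endpoints.
record Graph : Set where
  field
    V : ℕ
    E : ℕ
    ends : Fin E → Fin V × Fin V
open Graph public

Joins : (G : Graph) → Fin (E G) → Fin (V G) → Fin (V G) → Set
Joins G e u w = (ends G e ≡ (u , w)) ⊎ (ends G e ≡ (w , u))

data Walk (G : Graph) (S : Subset (E G)) : Fin (V G) → Fin (V G) → Set where
  nil  : ∀ {u} → Walk G S u u
  cons : ∀ {u w v} (e : Fin (E G)) → e ∈ S → Joins G e u w → Walk G S w v → Walk G S u v

walkEdges : ∀ {G S u v} → Walk G S u v → List (Fin (E G))
walkEdges nil = []
walkEdges (cons e _ _ p) = e ∷ walkEdges p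

walkStarts : ∀ {G S u v} → Walk G S u v → List (Fin (V G))
walkStarts nil = []
walkStarts {u = u} (cons e _ _ p) = u ∷ walkStarts p

IsCycle : ∀ {G S v} → Walk G S v v → Set
IsCycle nil = Data.Empty.⊥ where import Data.Empty
IsCycle p@(cons _ _ _ _) = Unique (walkEdges p) × Unique (walkStarts p)

ConnectedSub : (G : Graph) → Subset (E G) → Set
ConnectedSub G S = (u v : Fin (V G)) → Walk G S u v

Acyclic : (G : Graph) → Subset (E G) → Set
Acyclic G S = ¬ (Σ (Fin (V G)) λ v → Σ (Walk G S v v) IsCycle)

IsSpanningTree : (G : Graph) → Subset (E G) → Set
IsSpanningTree G T = ConnectedSub G T × Acyclic G T

allEdges : (G : Graph) → Subset (E G)
allEdges G = tabulate (λ _ → true)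

Connected : Graph → Set
Connected G = NonZero (V G) × ConnectedSub G (allEdges G)

-- Order map: φ T is a bijection Fin |E| → E(G); φ T ⟨$⟩ʳ k is the k-th smallest edge
-- (0-indexed).  Values on non-spanning-trees are irrelevant.
OrderMap : Graph → Set
OrderMap G = Subset (E G) → Permutation′ (E G)

-- Perfect binary trees of depth d whose internal nodes are labelled by edges
-- (leaves are unlabelled terminators, so a root-to-leaf path reads d labels).
data DTree (m : ℕ) : ℕ → Set where
  leaf : DTree m zero
  node : ∀ {d} → Fin m → DTree m d → DTree m d → DTree m (suc d)

pathLabels : ∀ {m d} → DTree m d → Vec Bool d → Vec (Fin m) d
pathLabels leaf [] = []
pathLabels (node e l r) (b ∷ bs) = e ∷ pathLabels (if b then r else l) bs

IsDecisionTree : (G : Graph) → DTree (E G) (E G) → Set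
IsDecisionTree G Δ = (bs : Vec Bool (E G)) →
  VUnique (pathLabels Δ bs) × ((e : Fin (E G)) → e VM.∈ pathLabels Δ bs)

ordering : ∀ {m d} → DTree m d → Subset m → Vec (Fin m) d
ordering leaf T = []
ordering (node e l r) T = e ∷ ordering (if lookup T e then r else l) T

TreeCompatible : (G : Graph) → OrderMap G → Set
TreeCompatible G φ = Σ (DTree (E G) (E G)) λ Δ → IsDecisionTree G Δ ×
  ((T : Subset (E G)) → IsSpanningTree G T →
     (k : Fin (E G)) → lookup (ordering Δ T) k ≡ φ T ⟨$⟩ʳ k)

-- {φ_1(T), …, φ_k(T)} (paper's 1-indexing) = edges of φ(T)-rank < k (0-indexed)
firstEdges : (G : Graph) → OrderMap G → Subset (E G) → ℕ → Subset (E G)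
firstEdges G φ T k = tabulate (λ e → toℕ (φ T ⟨$⟩ˡ e) <ᵇ k)

-- (⇒) If T and T' give the same answers to the first k questions asked along the
-- (Δ,T)-path, the (Δ,T)- and (Δ,T')-paths coincide for k+1 steps, so the first k+1
-- labels agree.
-- (⇐) Build Δ top-down.  A node at depth i is reached by a sequence of answers; if
-- some spanning tree T₀ is consistent with them, label the node by φ_{i+1}(T₀).  Every
-- spanning tree T consistent with those answers agrees with T₀ on φ_1(T),…,φ_i(T)
-- (by induction these are the edges asked so far), so the hypothesis gives
-- φ_{i+1}(T₀) = φ_{i+1}(T): the label does not depend on the choice of T₀, and every
-- spanning tree reads off φ(T) along its path.  Choosing T₀ constructively requires
-- deciding whether a set of edges is a spanning tree; walks and cycles can be found by
-- a bounded search, because both may be taken to visit distinct vertices.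
module Submission where

open import Defs
open import Data.Nat using (ℕ; zero; suc; _≤_; _<_; z≤n; s≤s; z<s; _+_; _<?_)
open import Data.Nat.Properties
  using (<ᵇ⇒<; <⇒<ᵇ; m<1+n⇒m<n∨m≡n; +-suc; +-identityʳ; ≤-refl; ≤-reflexive; <-irrefl; ≤-trans; n≤1+n; m<m+n)
open import Data.Bool as Bool using (Bool; true; false; if_then_else_; _∧_)
open import Data.Bool.Properties using (∧-identityʳ; ∧-zeroʳ; T-≡)
open import Data.Fin as F using (Fin; toℕ; fromℕ<)
open import Data.Fin.Properties using (toℕ-injective; toℕ-fromℕ<; toℕ<n; any?; all?; injective⇒≤)
open import Data.Fin.Subset using (Subset; _∩_) renaming (_∈_ to _∈ₛ_)
open import Data.Fin.Subset.Properties using (anySubset?) renaming (_∈?_ to _∈ₛ?_)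
open import Data.Fin.Permutation using (_⟨$⟩ʳ_; _⟨$⟩ˡ_; inverseʳ; inverseˡ)
open import Data.Vec using (Vec; []; _∷_; lookup; allFin)
open import Data.Vec.Properties using (lookup-zipWith; lookup∘tabulate)
open import Data.Vec.Relation.Binary.Pointwise.Extensional using (ext; Pointwise-≡⇒≡)
open import Data.Vec.Relation.Unary.Any using (here; there)
import Data.Vec.Relation.Unary.All as VAll
open import Data.Vec.Relation.Unary.All.Properties using (lookup⁻)
open import Data.Vec.Relation.Unary.AllPairs using () renaming ([] to []ᵖ; _∷_ to _∷ᵖ_)
open import Data.Vec.Relation.Unary.Unique.Propositional using () renaming (Unique to VUnique)
open import Data.Vec.Relation.Unary.Unique.Propositional.Properties using (tabulate⁺)
open import Data.Vec.Membership.Propositional using (_∈_)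
open import Data.Vec.Membership.Propositional.Properties using (∈-lookup; ∈-allFin⁺)
import Data.Vec.Membership.DecPropositional as VecDecMem
open import Data.List as List using (List; []; _∷_; length)
open import Data.List.Relation.Unary.All as All using (All; []; _∷_)
open import Data.List.Relation.Unary.Any using () renaming (here to hereₗ; there to thereₗ)
open import Data.List.Relation.Unary.AllPairs using ([]; _∷_)
open import Data.List.Relation.Unary.Unique.Propositional using (Unique)
import Data.List.Relation.Unary.Unique.DecPropositional as DecUnique
open import Data.List.Membership.Propositional using () renaming (_∈_ to _∈ₗ_)
open import Data.List.Membership.Propositional.Properties using () renaming (∈-lookup to ∈ₗ-lookup)
import Data.List.Membership.DecPropositional as ListDecMem
open import Data.Maybe using (Maybe; just; nothing)
open import Data.Product using (Σ; _×_; _,_; ∃; ∃₂; proj₁; proj₂)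
open import Data.Product.Properties using (≡-dec)
open import Data.Sum using (_⊎_; inj₁; inj₂)
open import Function using (_∘_; _⇔_; mk⇔; Equivalence; Injective)
open import Relation.Binary.PropositionalEquality using (_≡_; _≢_; refl; sym; trans; subst; cong; module ≡-Reasoning)
open import Relation.Binary.Definitions using (DecidableEquality)
open import Relation.Nullary using (Dec; yes; no; ¬_; contradiction)
open import Relation.Nullary.Decidable using (_×-dec_; _⊎-dec_; ¬?; map′)

lookup-injective : ∀ {A : Set} {xs : List A} → Unique xs → Injective _≡_ _≡_ (List.lookup xs)
lookup-injective {xs = _ ∷ _} (x∉ ∷ _) {F.zero} {F.zero} _ = refl
lookup-injective {xs = _ ∷ _} (x∉ ∷ _) {F.zero} {F.suc j} eq = contradiction eq (All.lookup x∉ (∈ₗ-lookup j))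
lookup-injective {xs = _ ∷ _} (x∉ ∷ _) {F.suc i} {F.zero} eq = contradiction (sym eq) (All.lookup x∉ (∈ₗ-lookup i))
lookup-injective {xs = _ ∷ _} (_ ∷ xs!) {F.suc i} {F.suc j} eq = cong F.suc (lookup-injective xs! eq)

unique⇒length≤ : ∀ {n} {xs : List (Fin n)} → Unique xs → length xs ≤ n
unique⇒length≤ xs! = injective⇒≤ (lookup-injective xs!)

∉⇒Unique-∷ : ∀ {A : Set} {x : A} {xs} → ¬ x ∈ₗ xs → Unique xs → Unique (x ∷ xs)
∉⇒Unique-∷ x∉ xs! = All.tabulate (λ y∈ x≡y → x∉ (subst (_∈ₗ _) (sym x≡y) y∈)) ∷ xs!

-- Deciding spanning trees

module WalkSearch (G : Graph) (S : Subset (E G)) where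

  open ListDecMem (F._≟_ {V G}) using () renaming (_∈?_ to _∈ₗ?_)

  unique? : ∀ {n} (xs : List (Fin n)) → Dec (Unique xs)
  unique? = DecUnique.unique? F._≟_

  joins? : ∀ e u w → Dec (Joins G e u w)
  joins? e u w = ends G e ≟ (u , w) ⊎-dec ends G e ≟ (w , u)
    where _≟_ = ≡-dec F._≟_ F._≟_

  BoundedWalk : ℕ → Fin (V G) → Fin (V G) → (List (Fin (E G)) → List (Fin (V G)) → Set) → Set
  BoundedWalk n u v R = Σ (Walk G S u v) λ w → length (walkStarts w) ≤ n × R (walkEdges w) (walkStarts w)

  boundedWalk-suc-⇔ : ∀ {n u v R} → BoundedWalk (suc n) u v R ⇔
    ((u ≡ v × R [] []) ⊎ ∃₂ λ e w → e ∈ₛ S × Joins G e u w × BoundedWalk n w v (λ es ss → R (e ∷ es) (u ∷ ss)))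
  boundedWalk-suc-⇔ = mk⇔
    (λ { (nil , _ , r) → inj₁ (refl , r)
       ; (cons e e∈S j w , s≤s ℓ≤n , r) → inj₂ (e , _ , e∈S , j , w , ℓ≤n , r) })
    (λ { (inj₁ (refl , r)) → nil , z≤n , r
       ; (inj₂ (e , _ , e∈S , j , w , ℓ≤n , r)) → cons e e∈S j w , s≤s ℓ≤n , r })

  boundedWalk? : ∀ n u v R → (∀ es ss → Dec (R es ss)) → Dec (BoundedWalk n u v R)
  boundedWalk? zero u v R R? with u F.≟ v | R? [] []
  ... | yes refl | yes r = yes (nil , z≤n , r)
  ... | yes refl | no ¬r = no λ { (nil , _ , r) → ¬r r ; (cons _ _ _ _ , () , _) }
  ... | no u≢v   | _     = no λ { (nil , _ , _) → u≢v refl ; (cons _ _ _ _ , () , _) }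
  boundedWalk? (suc n) u v R R? = map′ from to
    ((u F.≟ v ×-dec R? [] []) ⊎-dec
     any? λ e → any? λ w → e ∈ₛ? S ×-dec joins? e u w ×-dec
       boundedWalk? n w v (λ es ss → R (e ∷ es) (u ∷ ss)) (λ es ss → R? (e ∷ es) (u ∷ ss)))
    where open Equivalence (boundedWalk-suc-⇔ {n} {u} {v} {R})

  SimpleWalk : Fin (V G) → Fin (V G) → Set
  SimpleWalk u v = Σ (Walk G S u v) λ w → Unique (walkStarts w)

  simpleSuffix : ∀ {u w v} (q : Walk G S w v) → u ∈ₗ walkStarts q → Unique (walkStarts q) → SimpleWalk u v
  simpleSuffix q@(cons _ _ _ _) (hereₗ refl) q! = q , q!
  simpleSuffix (cons _ _ _ q) (thereₗ u∈q) (_ ∷ q!) = simpleSuffix q u∈q q!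

  consSimple : ∀ {u w v} e → e ∈ₛ S → Joins G e u w → SimpleWalk w v → SimpleWalk u v
  consSimple {u} e e∈S j (q , q!) with u ∈ₗ? walkStarts q
  ... | yes u∈q = simpleSuffix q u∈q q!
  ... | no u∉q  = cons e e∈S j q , ∉⇒Unique-∷ u∉q q!

  shortcut : ∀ {u v} → Walk G S u v → SimpleWalk u v
  shortcut nil = nil , []
  shortcut (cons e e∈S j q) = consSimple e e∈S j (shortcut q)

  walk? : ∀ u v → Dec (Walk G S u v)
  walk? u v with boundedWalk? (V G) u v (λ _ ss → Unique ss) (λ _ ss → unique? ss)
  ... | yes (w , _) = yes w
  ... | no ¬w = no λ w → let w′ , w′! = shortcut w in ¬w (w′ , unique⇒length≤ w′! , w′!)

  CycleShape : List (Fin (E G)) → List (Fin (V G)) → Set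
  CycleShape es ss = 0 < length es × Unique es × Unique ss

  isCycle⇔CycleShape : ∀ {v} (w : Walk G S v v) → IsCycle w ⇔ CycleShape (walkEdges w) (walkStarts w)
  isCycle⇔CycleShape nil = mk⇔ (λ ()) (λ ())
  isCycle⇔CycleShape (cons _ _ _ _) = mk⇔ (λ (es! , ss!) → z<s , es! , ss!) (λ (_ , es! , ss!) → es! , ss!)

  cycle? : ∀ v → Dec (Σ (Walk G S v v) IsCycle)
  cycle? v with boundedWalk? (V G) v v CycleShape (λ es ss → 0 <? length es ×-dec unique? es ×-dec unique? ss)
  ... | yes (w , _ , shape) = yes (w , Equivalence.from (isCycle⇔CycleShape w) shape)
  ... | no ¬w = no λ (w , cyc) → let shape = Equivalence.to (isCycle⇔CycleShape w) cyc in
                  ¬w (w , unique⇒length≤ (proj₂ (proj₂ shape)) , shape)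

isSpanningTree? : (G : Graph) (S : Subset (E G)) → Dec (IsSpanningTree G S)
isSpanningTree? G S = all? (λ u → all? (walk? u)) ×-dec ¬? (any? cycle?)
  where open WalkSearch G S

module _ {A : Set} where

  remove : ∀ {d} {x : A} (v : Vec A (suc d)) → x ∈ v → Vec A d
  remove (_ ∷ v) (here _) = v
  remove {suc _} (y ∷ v) (there x∈v) = y ∷ remove v x∈v

  ∈-remove⁻ : ∀ {d} {x e : A} (v : Vec A (suc d)) (x∈v : x ∈ v) → e ∈ remove v x∈v → e ∈ v
  ∈-remove⁻ (_ ∷ v) (here _) e∈ = there e∈
  ∈-remove⁻ {suc _} (y ∷ v) (there x∈v) (here e≡y) = here e≡y
  ∈-remove⁻ {suc _} (y ∷ v) (there x∈v) (there e∈) = there (∈-remove⁻ v x∈v e∈)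

  ∈-remove⁺ : ∀ {d} {x e : A} (v : Vec A (suc d)) (x∈v : x ∈ v) → e ∈ v → e ≢ x → e ∈ remove v x∈v
  ∈-remove⁺ (y ∷ v) (here x≡y) (here e≡y) e≢x = contradiction (trans e≡y (sym x≡y)) e≢x
  ∈-remove⁺ (y ∷ v) (here x≡y) (there e∈v) e≢x = e∈v
  ∈-remove⁺ {suc _} (y ∷ v) (there x∈v) (here e≡y) e≢x = here e≡y
  ∈-remove⁺ {suc _} (y ∷ v) (there x∈v) (there e∈v) e≢x = there (∈-remove⁺ v x∈v e∈v e≢x)

  all-∈ : ∀ {d} {P : A → Set} (v : Vec A d) → (∀ {e} → e ∈ v → P e) → VAll.All P v
  all-∈ v f = lookup⁻ (λ i → f (∈-lookup i v))

  remove-unique : ∀ {d} {x : A} (v : Vec A (suc d)) (x∈v : x ∈ v) → VUnique v → VUnique (remove v x∈v)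
  remove-unique (_ ∷ v) (here _) (_ ∷ᵖ v!) = v!
  remove-unique {suc _} (y ∷ v) (there x∈v) (y∉v ∷ᵖ v!) =
    all-∈ (remove v x∈v) (VAll.lookup y∉v ∘ ∈-remove⁻ v x∈v) ∷ᵖ remove-unique v x∈v v!

  ∉-remove : ∀ {d} {x : A} (v : Vec A (suc d)) (x∈v : x ∈ v) → VUnique v → ¬ x ∈ remove v x∈v
  ∉-remove (y ∷ v) (here x≡y) (y∉v ∷ᵖ _) x∈ = VAll.lookup y∉v x∈ (sym x≡y)
  ∉-remove {suc _} (y ∷ v) (there x∈v) (y∉v ∷ᵖ _) (here x≡y) = VAll.lookup y∉v x∈v (sym x≡y)
  ∉-remove {suc _} (y ∷ v) (there x∈v) (_ ∷ᵖ v!) (there x∈) = ∉-remove v x∈v v! x∈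

  Enumerates : ∀ {d} → Vec A d → Vec A d → Set
  Enumerates ls v = VUnique ls × (∀ {e} → e ∈ v → e ∈ ls) × (∀ {e} → e ∈ ls → e ∈ v)

  enumerates-∷ : DecidableEquality A → ∀ {d} {x : A} {v : Vec A (suc d)} {ls} (x∈v : x ∈ v) → VUnique v →
    Enumerates ls (remove v x∈v) → Enumerates (x ∷ ls) v
  enumerates-∷ _≟_ {x = x} {v = v} {ls} x∈v v! (ls! , ⊇ , ⊆) = x∷ls! , ⊇′ , ⊆′
    where
      x∷ls! : VUnique (x ∷ ls)
      x∷ls! = all-∈ ls (λ e∈ls x≡e → ∉-remove v x∈v v! (subst (_∈ _) (sym x≡e) (⊆ e∈ls))) ∷ᵖ ls!
      ⊇′ : ∀ {e} → e ∈ v → e ∈ x ∷ ls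
      ⊇′ {e} e∈v with e ≟ x
      ... | yes e≡x = here e≡x
      ... | no e≢x = there (⊇ (∈-remove⁺ v x∈v e∈v e≢x))
      ⊆′ : ∀ {e} → e ∈ x ∷ ls → e ∈ v
      ⊆′ (here refl) = x∈v
      ⊆′ (there e∈ls) = ∈-remove⁻ v x∈v (⊆ e∈ls)

lookup-∩ : ∀ {n} (p q : Subset n) i → lookup (p ∩ q) i ≡ lookup p i ∧ lookup q i
lookup-∩ p q i = lookup-zipWith _∧_ i p q

∩-≡⇒agree : ∀ {n} {p p′ F : Subset n} → p ∩ F ≡ p′ ∩ F → ∀ {e} → lookup F e ≡ true → lookup p e ≡ lookup p′ e
∩-≡⇒agree {p = p} {p′} {F} p∩F≡p′∩F {e} e∈F = begin
  lookup p e                ≡⟨ sym (∧-identityʳ _) ⟩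
  lookup p e ∧ true         ≡⟨ cong (lookup p e ∧_) (sym e∈F) ⟩
  lookup p e ∧ lookup F e   ≡⟨ sym (lookup-∩ p F e) ⟩
  lookup (p ∩ F) e          ≡⟨ cong (λ q → lookup q e) p∩F≡p′∩F ⟩
  lookup (p′ ∩ F) e         ≡⟨ lookup-∩ p′ F e ⟩
  lookup p′ e ∧ lookup F e  ≡⟨ cong (lookup p′ e ∧_) e∈F ⟩
  lookup p′ e ∧ true        ≡⟨ ∧-identityʳ _ ⟩
  lookup p′ e               ∎
  where open ≡-Reasoning

agree⇒∩-≡ : ∀ {n} {p p′ F : Subset n} → (∀ {e} → lookup F e ≡ true → lookup p e ≡ lookup p′ e) → p ∩ F ≡ p′ ∩ F
agree⇒∩-≡ {p = p} {p′} {F} agree = Pointwise-≡⇒≡ (ext pointwise)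
  where
    pointwise : ∀ e → lookup (p ∩ F) e ≡ lookup (p′ ∩ F) e
    pointwise e rewrite lookup-∩ p F e | lookup-∩ p′ F e with lookup F e in e∈F
    ... | true  = cong (_∧ true) (agree e∈F)
    ... | false = trans (∧-zeroʳ _) (sym (∧-zeroʳ _))

module OrderRank (G : Graph) (φ : OrderMap G) (T : Subset (E G)) where

  -- 0-indexed: φ_1(T) has rank 0
  rank : Fin (E G) → ℕ
  rank e = toℕ (φ T ⟨$⟩ˡ e)

  rank-φ : ∀ j → rank (φ T ⟨$⟩ʳ j) ≡ toℕ j
  rank-φ j = cong toℕ (inverseˡ (φ T))

  rank-injective : Injective _≡_ _≡_ rank
  rank-injective eq = trans (sym (inverseʳ (φ T))) (trans (cong (φ T ⟨$⟩ʳ_) (toℕ-injective eq)) (inverseʳ (φ T)))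

  firstEdges⁺ : ∀ {k e} → rank e < k → lookup (firstEdges G φ T k) e ≡ true
  firstEdges⁺ {e = e} r<k = trans (lookup∘tabulate _ e) (Equivalence.to T-≡ (<⇒<ᵇ r<k))

  firstEdges⁻ : ∀ {k e} → lookup (firstEdges G φ T k) e ≡ true → rank e < k
  firstEdges⁻ {e = e} e∈F = <ᵇ⇒< _ _ (Equivalence.from T-≡ (trans (sym (lookup∘tabulate _ e)) e∈F))

PrefixDetermined : (G : Graph) → OrderMap G → Set
PrefixDetermined G φ = (T T' : Subset (E G)) → IsSpanningTree G T → IsSpanningTree G T' →
  (k : Fin (E G)) → T ∩ firstEdges G φ T (toℕ k) ≡ T' ∩ firstEdges G φ T (toℕ k) →
  (j : Fin (E G)) → toℕ j ≤ toℕ k → φ T ⟨$⟩ʳ j ≡ φ T' ⟨$⟩ʳ j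

-- Decision trees

ordering-node : ∀ {m d} x (c : Bool → DTree m d) T → ordering (node x (c false) (c true)) T ≡ x ∷ ordering (c (lookup T x)) T
ordering-node x c T with lookup T x
... | false = refl
... | true  = refl

pathLabels-node : ∀ {m d} x (c : Bool → DTree m d) b bs → pathLabels (node x (c false) (c true)) (b ∷ bs) ≡ x ∷ pathLabels (c b) bs
pathLabels-node x c false bs = refl
pathLabels-node x c true  bs = refl

ordering-prefix : ∀ {m d} (Δ : DTree m d) (T T′ : Subset m) (k : ℕ) →
  (∀ i → toℕ i < k → lookup T (lookup (ordering Δ T) i) ≡ lookup T′ (lookup (ordering Δ T) i)) →
  ∀ j → toℕ j ≤ k → lookup (ordering Δ T) j ≡ lookup (ordering Δ T′) j
ordering-prefix (node e l r) T T′ k agree F.zero _ = refl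
ordering-prefix (node e l r) T T′ (suc k) agree (F.suc j) (s≤s j≤k) rewrite sym (agree F.zero z<s) =
  ordering-prefix (if lookup T e then r else l) T T′ k (λ i i<k → agree (F.suc i) (s≤s i<k)) j j≤k

treeCompatible⇒prefixDetermined : (G : Graph) (φ : OrderMap G) → TreeCompatible G φ → PrefixDetermined G φ
treeCompatible⇒prefixDetermined G φ (Δ , _ , Δ-orders) T T′ T-st T′-st k T∩F≡T′∩F j j≤k = begin
  φ T ⟨$⟩ʳ j                ≡⟨ sym (Δ-orders T T-st j) ⟩
  lookup (ordering Δ T) j   ≡⟨ ordering-prefix Δ T T′ (toℕ k) agree j j≤k ⟩
  lookup (ordering Δ T′) j  ≡⟨ Δ-orders T′ T′-st j ⟩
  φ T′ ⟨$⟩ʳ j               ∎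
  where
    open ≡-Reasoning
    agree : ∀ i → toℕ i < toℕ k → lookup T (lookup (ordering Δ T) i) ≡ lookup T′ (lookup (ordering Δ T) i)
    agree i i<k rewrite Δ-orders T T-st i =
      ∩-≡⇒agree T∩F≡T′∩F (firstEdges⁺ (subst (_< toℕ k) (sym (rank-φ i)) i<k))
      where open OrderRank G φ T

module Construction (G : Graph) (φ : OrderMap G) (prefix : PrefixDetermined G φ) where

  private
    n : ℕ
    n = E G

  open VecDecMem (F._≟_ {n}) using (_∈?_)

  History : Set
  History = List (Fin n × Bool)

  Consistent : Subset n → History → Set
  Consistent T h = All (λ (e , b) → lookup T e ≡ b) h

  ConsistentTree : History → Subset n → Set
  ConsistentTree h T = IsSpanningTree G T × Consistent T h

  consistentTree? : ∀ h T → Dec (ConsistentTree h T)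
  consistentTree? h T = isSpanningTree? G T ×-dec All.all? (λ (e , b) → lookup T e Bool.≟ b) h

  nextLabel : ℕ → History → Maybe (Fin n)
  nextLabel i h with anySubset? (consistentTree? h) | i <? n
  ... | yes (T₀ , _) | yes i<n = just (φ T₀ ⟨$⟩ʳ fromℕ< i<n)
  ... | _            | _       = nothing

  -- Off the paths of spanning trees the label is irrelevant: any unused edge will do.
  choose : ∀ {d} → Maybe (Fin n) → (v : Vec (Fin n) (suc d)) → Σ (Fin n) (_∈ v)
  choose (just x) (y ∷ v) with x ∈? (y ∷ v)
  ... | yes x∈v = x , x∈v
  ... | no _    = y , here refl
  choose nothing (y ∷ v) = y , here refl

  choose-just : ∀ {d x} {v : Vec (Fin n) (suc d)} → x ∈ v → proj₁ (choose (just x) v) ≡ x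
  choose-just {x = x} {y ∷ v} x∈v with x ∈? (y ∷ v)
  ... | yes _  = refl
  ... | no x∉v = contradiction x∈v x∉v

  -- A subtree of depth d sits at depth i of Δ; h records the answers given on the way
  -- down and v the edges not yet asked.
  mutual
    build : (d i : ℕ) → History → Vec (Fin n) d → DTree n d
    build zero    _ _ []  = leaf
    build (suc d) i h v with choose (nextLabel i h) v
    ... | x , x∈v = node x (child d i h v x∈v false) (child d i h v x∈v true)

    child : (d i : ℕ) → History → (v : Vec (Fin n) (suc d)) {x : Fin n} → x ∈ v → Bool → DTree n d
    child d i h v {x} x∈v b = build d (suc i) ((x , b) ∷ h) (remove v x∈v)

  build-enumerates : ∀ d i h (v : Vec (Fin n) d) → VUnique v → (bs : Vec Bool d) →
    Enumerates (pathLabels (build d i h v) bs) v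
  build-enumerates zero _ _ [] _ [] = []ᵖ , (λ ()) , (λ ())
  build-enumerates (suc d) i h v v! (b ∷ bs) with choose (nextLabel i h) v
  ... | x , x∈v rewrite pathLabels-node x (child d i h v x∈v) b bs =
    enumerates-∷ F._≟_ x∈v v! (build-enumerates d (suc i) _ (remove v x∈v) (remove-unique v x∈v v!) bs)

  Δ : DTree n n
  Δ = build n 0 [] (allFin n)

  Δ-isDecisionTree : IsDecisionTree G Δ
  Δ-isDecisionTree bs =
    let ls! , ⊇ , _ = build-enumerates n 0 [] (allFin n) (tabulate⁺ (λ eq → eq)) bs in ls! , λ e → ⊇ (∈-allFin⁺ e)

  module Along (T : Subset n) (T-st : IsSpanningTree G T) where

    open OrderRank G φ T

    Covers : ℕ → History → Set
    Covers i h = ∀ {e} → rank e < i → ∃ λ b → (e , b) ∈ₗ h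

    Remaining : ∀ {d} → ℕ → Vec (Fin n) d → Set
    Remaining i v = ∀ j → i ≤ toℕ j → φ T ⟨$⟩ʳ j ∈ v

    nextLabel-correct : ∀ {i h} → Consistent T h → Covers i h → ∀ k → toℕ k ≡ i → nextLabel i h ≡ just (φ T ⟨$⟩ʳ k)
    nextLabel-correct {i} {h} T-h cov k k≡i with anySubset? (consistentTree? h) | i <? n
    ... | yes (T₀ , T₀-st , T₀-h) | yes i<n = cong just (begin
      φ T₀ ⟨$⟩ʳ fromℕ< i<n  ≡⟨ cong (φ T₀ ⟨$⟩ʳ_) (toℕ-injective (trans (toℕ-fromℕ< i<n) (sym k≡i))) ⟩
      φ T₀ ⟨$⟩ʳ k           ≡⟨ sym (prefix T T₀ T-st T₀-st k (agree⇒∩-≡ agree) k ≤-refl) ⟩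
      φ T ⟨$⟩ʳ k            ∎)
      where
        open ≡-Reasoning
        agree : ∀ {e} → lookup (firstEdges G φ T (toℕ k)) e ≡ true → lookup T e ≡ lookup T₀ e
        agree e∈F with cov (subst (_ <_) k≡i (firstEdges⁻ e∈F))
        ... | _ , e∈h = trans (All.lookup T-h e∈h) (sym (All.lookup T₀-h e∈h))
    ... | yes _ | no i≮n = contradiction (subst (_< n) k≡i (toℕ<n k)) i≮n
    ... | no none | _    = contradiction (T , T-st , T-h) none

    chosen-rank : ∀ {d i h} {v : Vec (Fin n) (suc d)} → Consistent T h → Covers i h → Remaining i v → (i<n : i < n) →
      rank (proj₁ (choose (nextLabel i h) v)) ≡ i
    chosen-rank {i = i} {h} {v} T-h cov rem i<n = begin
      rank (proj₁ (choose (nextLabel i h) v))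
        ≡⟨ cong (λ l → rank (proj₁ (choose l v))) (nextLabel-correct T-h cov kᵢ kᵢ≡i) ⟩
      rank (proj₁ (choose (just (φ T ⟨$⟩ʳ kᵢ)) v))
        ≡⟨ cong rank (choose-just (rem kᵢ (≤-reflexive (sym kᵢ≡i)))) ⟩
      rank (φ T ⟨$⟩ʳ kᵢ)
        ≡⟨ rank-φ kᵢ ⟩
      toℕ kᵢ
        ≡⟨ kᵢ≡i ⟩
      i ∎
      where
        open ≡-Reasoning
        kᵢ = fromℕ< i<n
        kᵢ≡i = toℕ-fromℕ< i<n

    covers-∷ : ∀ {i h x} b → rank x ≡ i → Covers i h → Covers (suc i) ((x , b) ∷ h)
    covers-∷ b x-rank cov r<1+i with m<1+n⇒m<n∨m≡n r<1+i
    ... | inj₁ r<i = let b′ , e∈h = cov r<i in b′ , thereₗ e∈h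
    ... | inj₂ r≡i = b , hereₗ (cong (_, b) (rank-injective (trans r≡i (sym x-rank))))

    remaining-remove : ∀ {d i x} {v : Vec (Fin n) (suc d)} (x∈v : x ∈ v) → rank x ≡ i → Remaining i v →
      Remaining (suc i) (remove v x∈v)
    remaining-remove {i = i} {x} {v} x∈v x-rank rem j 1+i≤j =
      ∈-remove⁺ v x∈v (rem j (≤-trans (n≤1+n i) 1+i≤j)) φⱼ≢x
      where
        φⱼ≢x : φ T ⟨$⟩ʳ j ≢ x
        φⱼ≢x φⱼ≡x = <-irrefl (trans (sym x-rank) (trans (cong rank (sym φⱼ≡x)) (rank-φ j))) 1+i≤j

    build-ordering : ∀ d i h (v : Vec (Fin n) d) → i + d ≡ n → Consistent T h → Covers i h → Remaining i v →
      ∀ j → rank (lookup (ordering (build d i h v) T) j) ≡ i + toℕ j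
    build-ordering (suc d) i h v i+d≡n T-h cov rem j
      with choose (nextLabel i h) v | chosen-rank T-h cov rem (subst (i <_) i+d≡n (m<m+n i z<s))
    ... | x , x∈v | x-rank with j
    ...   | F.zero  = trans x-rank (sym (+-identityʳ i))
    ...   | F.suc j = begin
      rank (lookup (ordering (node x (c false) (c true)) T) (F.suc j))
        ≡⟨ cong (λ o → rank (lookup o (F.suc j))) (ordering-node x c T) ⟩
      rank (lookup (ordering (c (lookup T x)) T) j)
        ≡⟨ build-ordering d (suc i) _ (remove v x∈v) (trans (sym (+-suc i d)) i+d≡n)
             (refl ∷ T-h) (covers-∷ (lookup T x) x-rank cov) (remaining-remove x∈v x-rank rem) j ⟩
      suc i + toℕ j
        ≡⟨ sym (+-suc i (toℕ j)) ⟩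
      i + suc (toℕ j) ∎
      where
        open ≡-Reasoning
        c = child d i h v x∈v

    Δ-orders : ∀ k → lookup (ordering Δ T) k ≡ φ T ⟨$⟩ʳ k
    Δ-orders k = rank-injective (trans
      (build-ordering n 0 [] (allFin n) refl [] (λ ()) (λ j _ → ∈-allFin⁺ _) k)
      (sym (rank-φ k)))

prefixDetermined⇒treeCompatible : (G : Graph) (φ : OrderMap G) → PrefixDetermined G φ → TreeCompatible G φ
prefixDetermined⇒treeCompatible G φ prefix = Δ , Δ-isDecisionTree , Along.Δ-orders
  where open Construction G φ prefix

mainTheorem12 : (G : Graph) → Connected G → (φ : OrderMap G) →
    (TreeCompatible G φ →
       ((T T' : Subset (E G)) → IsSpanningTree G T → IsSpanningTree G T' →
        (k : Fin (E G)) →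
        T ∩ firstEdges G φ T (toℕ k) ≡ T' ∩ firstEdges G φ T (toℕ k) →
        (j : Fin (E G)) → toℕ j ≤ toℕ k → φ T ⟨$⟩ʳ j ≡ φ T' ⟨$⟩ʳ j))
    × (((T T' : Subset (E G)) → IsSpanningTree G T → IsSpanningTree G T' →
        (k : Fin (E G)) →
        T ∩ firstEdges G φ T (toℕ k) ≡ T' ∩ firstEdges G φ T (toℕ k) →
        (j : Fin (E G)) → toℕ j ≤ toℕ k → φ T ⟨$⟩ʳ j ≡ φ T' ⟨$⟩ʳ j)
       → TreeCompatible G φ)
mainTheorem12 G _ φ = treeCompatible⇒prefixDetermined G φ , prefixDetermined⇒treeCompatible G φ
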